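{- Let $\mathbf{u}$ be an eventually periodic infinite binary word whose set of factors contains infinitely many antipalindromes. If $\mathbf{u}$ is recurrent, then $\mathbf{u}$ is a fixed point of a morphism in class $\mathcal{A}_1$.
   Context: $\mathrm{E}(w_1\cdots w_n)=(1-w_n)\cdots(1-w_1)$; antipalindrome: $\mathrm{E}(w)=w$. Eventually periodic: $\mathbf{u}=vw^\infty$ with $w$ nonempty. Recurrent: every factor of $\mathbf{u}$ occurs infinitely many times in $\mathbf{u}$. Class $\mathcal{A}_1$: morphisms $\varphi$ of $\{0,1\}^*$ with $\varphi(0)=\mathfrak{p}\mathfrak{s}$, $\varphi(1)=\mathrm{E}(\mathfrak{p})\mathfrak{s}$ for some nonempty word $\mathfrak{p}$ and antipalindrome $\mathfrak{s}$. Fixed point: $\varphi(\mathbf{u})=\mathbf{u}$. -}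

module Defs where

open import Data.Bool using (Bool; true; false; not)
open import Data.Nat using (ℕ; zero; suc; _+_; _≤_; _<_)
open import Data.List using (List; []; _∷_; _++_; reverse; map; length; concat; concatMap)
open import Data.List.Membership.Propositional using (_∈_)
open import Data.Product using (Σ; ∃; _×_; _,_)
open import Relation.Binary.PropositionalEquality using (_≡_)
open import Relation.Nullary using (¬_)

-- Binary letters 0,1 are represented by false,true.
Word : Set
Word = List Bool

InfWord : Set
InfWord = ℕ → Bool

E : Word → Word
E w = reverse (map not w)

Antipalindrome : Word → Set
Antipalindrome w = E w ≡ w

slice : InfWord → ℕ → ℕ → Word
slice u i zero    = []
slice u i (suc n) = u i ∷ slice u (suc i) n

OccursAt : Word → InfWord → ℕ → Set
OccursAt w u i = slice u i (length w) ≡ w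

Factor : Word → InfWord → Set
Factor w u = ∃ λ i → OccursAt w u i

-- The set of factors of u contains infinitely many antipalindromes:
-- no finite list of words contains all antipalindromic factors of u.
InfManyAntipalFactors : InfWord → Set
InfManyAntipalFactors u =
  (F : List Word) → ∃ λ w → Factor w u × Antipalindrome w × ¬ (w ∈ F)

-- u = v w^∞ with w nonempty
EventuallyPeriodic : InfWord → Set
EventuallyPeriodic u =
  ∃ λ k → ∃ λ p → 1 ≤ p × ((n : ℕ) → k ≤ n → u (n + p) ≡ u n)

Recurrent : InfWord → Set
Recurrent u = (w : Word) → Factor w u → (N : ℕ) → ∃ λ i → N ≤ i × OccursAt w u i

-- morphisms of {0,1}^* are determined by the images of the letters
Morphism : Set
Morphism = Bool → Word

applyM : Morphism → Word → Word
applyM φ w = concatMap φ w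

InA₁ : Morphism → Set
InA₁ φ = ∃ λ p → ∃ λ s → 1 ≤ length p × Antipalindrome s
         × φ false ≡ p ++ s × φ true ≡ E p ++ s

-- φ(u) = u : for every prefix x of u, φ(x) is a prefix of u.
-- (Images under φ ∈ A₁ are nonempty, so φ(u) is the limit of these words.)
FixedPoint : Morphism → InfWord → Set
FixedPoint φ u = (n : ℕ) → let x = applyM φ (slice u 0 n) in slice u 0 (length x) ≡ x

module Submission where

-- A recurrent, eventually periodic word is purely periodic, say
-- with period P ≥ 1.  Having infinitely many antipalindromic factors, u has
-- one of length at least P + P + P.  In a P-periodic word, stripping equally
-- long borders from an antipalindromic factor and translating it by a multiple
-- of P keeps it an antipalindromic factor.  This is used twice:
--   * to move the long antipalindrome to the origin, which gives an
--     antipalindromic prefix A = u[0,a) with P ≤ a;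
--   * to find an antipalindrome B = u[a,a+b) right after A such that a + b is
--     a multiple of P.
-- Then v = A B is a period block of u, the constant morphism 0,1 ↦ v lies in
-- A₁ (take p = A and s = B, using E(A) = A), and u = v^∞ is its fixed point.

open import Defs
open import Data.Bool using (false; true; not)
open import Data.Nat using (ℕ; zero; suc; _+_; _*_; _≤_; _<_; z≤n; s≤s; NonZero; >-nonZero; >-nonZero⁻¹)
open import Data.Nat.Properties
open import Data.Nat.DivMod using (_/_; _%_; m≡m%n+[m/n]*n; m%n<n; m≥n⇒m/n>0)
open import Data.Nat.Tactic.RingSolver using (solve-∀)
open import Data.List using (List; []; _∷_; _++_; map; length)
open import Data.List.Properties using (∷-injective; ++-assoc; map-++; reverse-++; length-reverse; length-map)
open import Data.List.Membership.Propositional using (_∈_)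
open import Data.List.Membership.Propositional.Properties using (∈-map⁺; ∈-++⁺ˡ; ∈-++⁺ʳ)
open import Data.List.Relation.Unary.Any using (here)
open import Data.Product using (∃; _×_; _,_; proj₁; proj₂)
open import Data.Sum using (inj₁; inj₂)
open import Relation.Binary.PropositionalEquality
open ≡-Reasoning

++-cancel-equal-length : ∀ {A : Set} (xs ys zs ws : List A) → length xs ≡ length ys
                       → xs ++ zs ≡ ys ++ ws → xs ≡ ys × zs ≡ ws
++-cancel-equal-length []       []       zs ws _   eq = refl , eq
++-cancel-equal-length (x ∷ xs) (y ∷ ys) zs ws len eq with ∷-injective eq
... | refl , eq′ with ++-cancel-equal-length xs ys zs ws (suc-injective len) eq′
... | refl , eq″ = refl , eq″

E-++ : ∀ x y → E (x ++ y) ≡ E y ++ E x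
E-++ x y rewrite map-++ not x y = reverse-++ (map not x) (map not y)

length-E : ∀ x → length (E x) ≡ length x
length-E x = trans (length-reverse (map not x)) (length-map not x)

-- Stripping borders of equal length from an antipalindrome leaves an
-- antipalindrome: E(x w y) = E(y) E(w) E(x) = x w y forces E(w) = w.
antipalindrome-inner : ∀ x w y → length x ≡ length y
                     → Antipalindrome (x ++ (w ++ y)) → Antipalindrome w
antipalindrome-inner x w y len anti =
  proj₁ (++-cancel-equal-length (E w) w (E x) y (length-E w) (proj₂ outer))
  where
  unfolded : E y ++ (E w ++ E x) ≡ x ++ (w ++ y)
  unfolded = begin
    E y ++ (E w ++ E x) ≡⟨ cong (E y ++_) (E-++ x w) ⟨
    E y ++ E (x ++ w)   ≡⟨ E-++ (x ++ w) y ⟨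
    E ((x ++ w) ++ y)   ≡⟨ cong E (++-assoc x w y) ⟩
    E (x ++ (w ++ y))   ≡⟨ anti ⟩
    x ++ (w ++ y)       ∎
  outer : E y ≡ x × E w ++ E x ≡ w ++ y
  outer = ++-cancel-equal-length (E y) x (E w ++ E x) (w ++ y)
            (trans (length-E y) (sym len)) unfolded

length-slice : ∀ (u : InfWord) i n → length (slice u i n) ≡ n
length-slice u i zero    = refl
length-slice u i (suc n) = cong suc (length-slice u (suc i) n)

slice-++ : ∀ (u : InfWord) i m n → slice u i (m + n) ≡ slice u i m ++ slice u (i + m) n
slice-++ u i zero    n rewrite +-identityʳ i = refl
slice-++ u i (suc m) n rewrite +-suc i m     = cong (u i ∷_) (slice-++ u (suc i) m n)

slice-≡-letter : ∀ (u : InfWord) i j l → slice u i l ≡ slice u j l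
               → ∀ t → t < l → u (i + t) ≡ u (j + t)
slice-≡-letter u i j (suc l) eq zero    _ rewrite +-identityʳ i | +-identityʳ j =
  proj₁ (∷-injective eq)
slice-≡-letter u i j (suc l) eq (suc t) (s≤s t<l) rewrite +-suc i t | +-suc j t =
  slice-≡-letter u (suc i) (suc j) l (proj₂ (∷-injective eq)) t t<l

slice-length-self : ∀ (u : InfWord) i l x → x ≡ slice u i l → slice u i (length x) ≡ x
slice-length-self u i l x eq = trans (cong (slice u i) (trans (cong length eq) (length-slice u i l)))
                                     (sym eq)

Periodic : InfWord → ℕ → Set
Periodic u P = ∀ n → u (n + P) ≡ u n

periodic-multiple : ∀ {u P} → Periodic u P → ∀ c → Periodic u (c * P)
periodic-multiple {u} {P} per zero    n = cong u (+-identityʳ n)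
periodic-multiple {u} {P} per (suc c) n =
  trans (cong u (sym (+-assoc n P (c * P)))) (trans (periodic-multiple per c (n + P)) (per n))

slice-translate : ∀ {u P} → Periodic u P → ∀ i l → slice u (i + P) l ≡ slice u i l
slice-translate per i zero    = refl
slice-translate per i (suc l) = cong₂ _∷_ (per i) (slice-translate per (suc i) l)

slice-translate-multiple : ∀ {u P} → Periodic u P → ∀ c i l → slice u (i + c * P) l ≡ slice u i l
slice-translate-multiple per c = slice-translate (periodic-multiple per c)

-- A recurrent word that is periodic from position k on is periodic: the
-- factor u[n, n+P] reoccurs at some position i ≥ k, where periodicity holds.
recurrent-periodic : ∀ {u} k P → Recurrent u → (∀ n → k ≤ n → u (n + P) ≡ u n) → Periodic u P
recurrent-periodic {u} k P rec late n with rec (slice u n (suc P)) (n , slice-length-self u n (suc P) _ refl) k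
... | i , k≤i , occ = begin
    u (n + P) ≡⟨ letter P (n<1+n P) ⟨
    u (i + P) ≡⟨ late i k≤i ⟩
    u i       ≡⟨ cong u (+-identityʳ i) ⟨
    u (i + 0) ≡⟨ letter 0 (s≤s z≤n) ⟩
    u (n + 0) ≡⟨ cong u (+-identityʳ n) ⟩
    u n       ∎
  where
  letter : ∀ t → t < suc P → u (i + t) ≡ u (n + t)
  letter = slice-≡-letter u i n (suc P)
             (trans (cong (slice u i) (sym (length-slice u n (suc P)))) occ)

AntipalindromeAt : InfWord → ℕ → ℕ → Set
AntipalindromeAt u i l = Antipalindrome (slice u i l)

antipalindrome-strip : ∀ u i d m → AntipalindromeAt u i (d + (m + d)) → AntipalindromeAt u (i + d) m
antipalindrome-strip u i d m anti
  rewrite slice-++ u i d (m + d) | slice-++ u (i + d) m d =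
  antipalindrome-inner (slice u i d) (slice u (i + d) m) (slice u (i + d + m) d)
    (trans (length-slice u i d) (sym (length-slice u (i + d + m) d))) anti

-- An antipalindromic factor of length P + P + m in a P-periodic word yields an
-- antipalindromic prefix of length at least m: strip the d ≤ P letters that
-- bring the start to the next multiple of P, then translate to the origin.
antipalindromic-prefix : ∀ {u P} .{{_ : NonZero P}} → Periodic u P → ∀ i m
                       → AntipalindromeAt u i (P + P + m) → ∃ λ a → m ≤ a × AntipalindromeAt u 0 a
antipalindromic-prefix {u} {P} per i m anti =
  a , m≤n+m m (r + r) ,
  subst Antipalindrome (slice-translate-multiple per (suc q) 0 a)
    (subst (λ j → AntipalindromeAt u j a) start-aligned
      (antipalindrome-strip u i d a (subst (AntipalindromeAt u i) length-split anti)))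
  where
  r = i % P
  q = i / P
  d = proj₁ (m≤n⇒∃[o]m+o≡n (<⇒≤ (m%n<n i P)))
  r+d≡P : r + d ≡ P
  r+d≡P = proj₂ (m≤n⇒∃[o]m+o≡n (<⇒≤ (m%n<n i P)))
  a = r + r + m
  length-split : P + P + m ≡ d + (a + d)
  length-split = subst (λ X → X + X + m ≡ d + (a + d)) r+d≡P (regroup r d m)
    where
    regroup : ∀ r d m → (r + d) + (r + d) + m ≡ d + ((r + r + m) + d)
    regroup = solve-∀
  start-aligned : i + d ≡ 0 + suc q * P
  start-aligned = begin
    i + d             ≡⟨ cong (_+ d) (m≡m%n+[m/n]*n i P) ⟩
    r + q * P + d     ≡⟨ +-assoc r (q * P) d ⟩
    r + (q * P + d)   ≡⟨ cong (r +_) (+-comm (q * P) d) ⟩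
    r + (d + q * P)   ≡⟨ +-assoc r d (q * P) ⟨
    (r + d) + q * P   ≡⟨ cong (_+ q * P) r+d≡P ⟩
    P + q * P         ∎

-- An antipalindromic prefix u[0,a) with a ≥ P is followed by an antipalindrome
-- u[a,a+b) such that a + b is again a period: with a = r + jP (0 ≤ r < P ≤ jP),
-- strip r letters from each end of the copy u[jP, jP+a) of the prefix.
antipalindromic-complement : ∀ {u P} .{{_ : NonZero P}} → Periodic u P → ∀ a → P ≤ a
                           → AntipalindromeAt u 0 a → ∃ λ b → AntipalindromeAt u a b × Periodic u (a + b)
antipalindromic-complement {u} {P} per a P≤a anti =
  b ,
  subst (λ k → AntipalindromeAt u k b) (trans (+-comm (j * P) r) (sym a≡r+jP))
    (antipalindrome-strip u (j * P) r b
      (subst (AntipalindromeAt u (j * P)) length-split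
        (subst Antipalindrome (sym (slice-translate-multiple per j 0 a)) anti))) ,
  subst (Periodic u) (sym period) (periodic-multiple per (j + j))
  where
  r = a % P
  j = a / P
  a≡r+jP : a ≡ r + j * P
  a≡r+jP = m≡m%n+[m/n]*n a P
  r≤jP : r ≤ j * P
  r≤jP = ≤-trans (<⇒≤ (m%n<n a P))
                 (subst (_≤ j * P) (*-identityˡ P) (*-monoˡ-≤ P (m≥n⇒m/n>0 P≤a)))
  b = proj₁ (m≤n⇒∃[o]m+o≡n r≤jP)
  r+b≡jP : r + b ≡ j * P
  r+b≡jP = proj₂ (m≤n⇒∃[o]m+o≡n r≤jP)
  length-split : a ≡ r + (b + r)
  length-split = trans a≡r+jP (cong (r +_) (trans (sym r+b≡jP) (+-comm r b)))
  period : a + b ≡ (j + j) * P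
  period = begin
    a + b             ≡⟨ cong (_+ b) a≡r+jP ⟩
    r + j * P + b     ≡⟨ cong (_+ b) (+-comm r (j * P)) ⟩
    j * P + r + b     ≡⟨ +-assoc (j * P) r b ⟩
    j * P + (r + b)   ≡⟨ cong (j * P +_) r+b≡jP ⟩
    j * P + j * P     ≡⟨ *-distribʳ-+ P j j ⟨
    (j + j) * P       ∎

wordsOfLength : ℕ → List Word
wordsOfLength zero    = [] ∷ []
wordsOfLength (suc n) = map (false ∷_) (wordsOfLength n) ++ map (true ∷_) (wordsOfLength n)

∈-wordsOfLength : ∀ w → w ∈ wordsOfLength (length w)
∈-wordsOfLength []          = here refl
∈-wordsOfLength (false ∷ w) = ∈-++⁺ˡ (∈-map⁺ (false ∷_) (∈-wordsOfLength w))
∈-wordsOfLength (true ∷ w)  = ∈-++⁺ʳ _ (∈-map⁺ (true ∷_) (∈-wordsOfLength w))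

wordsShorterThan : ℕ → List Word
wordsShorterThan zero    = []
wordsShorterThan (suc L) = wordsOfLength L ++ wordsShorterThan L

∈-wordsShorterThan : ∀ w L → length w < L → w ∈ wordsShorterThan L
∈-wordsShorterThan w (suc L) lt with m<1+n⇒m<n∨m≡n lt
... | inj₁ lt′  = ∈-++⁺ʳ _ (∈-wordsShorterThan w L lt′)
... | inj₂ refl = ∈-++⁺ˡ (∈-wordsOfLength w)

-- There are only finitely many words shorter than L, so some antipalindromic
-- factor has length at least L.
long-antipalindromic-factor : ∀ {u} → InfManyAntipalFactors u → ∀ L
                            → ∃ λ i → ∃ λ m → AntipalindromeAt u i (L + m)
long-antipalindromic-factor {u} inf L with inf (wordsShorterThan L)
... | w , (i , occ) , anti , w∉ =
  i , m , subst (AntipalindromeAt u i) (sym L+m≡|w|) (subst Antipalindrome (sym occ) anti)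
  where
  L≤|w| : L ≤ length w
  L≤|w| = ≮⇒≥ (λ lt → w∉ (∈-wordsShorterThan w L lt))
  m = proj₁ (m≤n⇒∃[o]m+o≡n L≤|w|)
  L+m≡|w| : L + m ≡ length w
  L+m≡|w| = proj₂ (m≤n⇒∃[o]m+o≡n L≤|w|)

-- A constant morphism whose image factors as (antipalindrome)(antipalindrome)
-- lies in A₁, since then E(p) s = p s.
constant-morphism-A₁ : ∀ v p s → v ≡ p ++ s → 1 ≤ length p → Antipalindrome p → Antipalindrome s
                     → InA₁ (λ _ → v)
constant-morphism-A₁ v p s v≡ps nonempty anti-p anti-s =
  p , s , nonempty , anti-s , v≡ps , trans v≡ps (cong (_++ s) (sym anti-p))

period-block-image : ∀ {u M} → Periodic u M → ∀ x c
                   → applyM (λ _ → slice u 0 M) x ≡ slice u (c * M) (length x * M)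
period-block-image         per []      c = refl
period-block-image {u} {M} per (_ ∷ x) c = begin
  slice u 0 M ++ applyM (λ _ → slice u 0 M) x
    ≡⟨ cong₂ _++_ (sym (slice-translate-multiple per c 0 M)) (period-block-image per x (suc c)) ⟩
  slice u (c * M) M ++ slice u (M + c * M) (length x * M)
    ≡⟨ cong (λ k → slice u (c * M) M ++ slice u k (length x * M)) (+-comm M (c * M)) ⟩
  slice u (c * M) M ++ slice u (c * M + M) (length x * M)
    ≡⟨ slice-++ u (c * M) M (length x * M) ⟨
  slice u (c * M) (M + length x * M) ∎

period-block-fixed : ∀ {u M} → Periodic u M → FixedPoint (λ _ → slice u 0 M) u
period-block-fixed {u} {M} per n =
  slice-length-self u 0 (n * M) _
    (trans (period-block-image per (slice u 0 n) 0) (cong (λ k → slice u 0 (k * M)) (length-slice u 0 n)))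

periodic-A₁-fixed-point : ∀ {u P} .{{_ : NonZero P}} → Periodic u P → InfManyAntipalFactors u
                        → ∃ λ φ → InA₁ φ × FixedPoint φ u
periodic-A₁-fixed-point {u} {P} per inf
  with long-antipalindromic-factor inf (P + P + P)
... | i , m , long
  with antipalindromic-prefix per i (P + m) (subst (AntipalindromeAt u i) (+-assoc (P + P) P m) long)
... | a , P+m≤a , prefix
  with antipalindromic-complement per a (≤-trans (m≤m+n P m) P+m≤a) prefix
... | b , complement , per-ab =
  (λ _ → slice u 0 (a + b)) ,
  constant-morphism-A₁ _ (slice u 0 a) (slice u a b) (slice-++ u 0 a b) nonempty prefix complement ,
  period-block-fixed per-ab
  where
  nonempty : 1 ≤ length (slice u 0 a)
  nonempty = subst (1 ≤_) (sym (length-slice u 0 a)) (≤-trans (>-nonZero⁻¹ P) (≤-trans (m≤m+n P m) P+m≤a))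

lemma26 : (u : InfWord) → EventuallyPeriodic u → InfManyAntipalFactors u
          → Recurrent u → ∃ λ φ → InA₁ φ × FixedPoint φ u
lemma26 u (k , P , 1≤P , late) inf rec =
  periodic-A₁-fixed-point {{>-nonZero 1≤P}} (recurrent-periodic k P rec late) inf
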